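{- Let $T$ be a pre-Galois word and $G_o$ an odd-length Galois root of $T$ such that $T=G_o^kG_o'$ with an integer $k\ge2$ and $G_o'$ a prefix of $G_o$. Then $T$ has no Galois root of even length.
   Context: An integer $p\in[1..|W|]$ is a period of $W$ if $W[i+p]=W[i]$ for all $i\in[1..|W|-p]$. Alternating order: for words $S,T$ with $S^\omega\neq T^\omega$ ($X^\omega$ the infinite repetition of $X$), let $j$ be the first position with $S^\omega[j]\neq T^\omega[j]$; $S\prec_{\mathrm{alt}}T$ if $j$ is odd and $S^\omega[j]<T^\omega[j]$, or $j$ is even and $S^\omega[j]>T^\omega[j]$. $S=_{\mathrm{alt}}T$ if $S^\omega=T^\omega$; $\varepsilon\succ_{\mathrm{alt}}X$ for every nonempty $X$. A word is Galois if it is strictly smaller with respect to $\prec_{\mathrm{alt}}$ than all its other cyclic rotations. A word $T$ is pre-Galois if every proper suffix $S$ of $T$ is a prefix of $T$ or satisfies $S\succ_{\mathrm{alt}}T$. A Galois root of a pre-Galois word $T$ is a prefix $P$ of $T$ such that $|P|$ is a period of $T$ and $P$ is Galois. -}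

module Defs where

open import Level using (Level)
open import Data.Nat using (ℕ; zero; suc; _+_; _<_; _≤_; _%_)
open import Data.Nat.DivMod using (_mod_)
open import Data.List using (List; []; _∷_; length; drop; take; _++_; concat; replicate; lookup)
open import Data.Maybe using (Maybe; just; nothing)
open import Data.Sum using (_⊎_)
open import Data.Product using (Σ; ∃; _×_; _,_)
open import Relation.Binary.PropositionalEquality using (_≡_)
open import Relation.Binary.Structures using (IsStrictTotalOrder)
open import Relation.Nullary using (¬_)

module Words {A : Set} (_<ₐ_ : A → A → Set) where

  Word : Set
  Word = List A

  at : Word → ℕ → Maybe A
  at []       _       = nothing
  at (x ∷ xs) zero    = just x
  at (x ∷ xs) (suc i) = at xs i

  IsPeriod : ℕ → Word → Set
  IsPeriod p W = 1 ≤ p × p ≤ length W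
               × (∀ i → i + p < length W → at W (i + p) ≡ at W i)

  IsPrefix : Word → Word → Set
  IsPrefix P T = ∃ λ R → P ++ R ≡ T

  -- X^ω for a nonempty word X = x ∷ xs, as a 0-indexed infinite sequence
  ω : A → List A → ℕ → A
  ω x xs i = lookup (x ∷ xs) (i mod length (x ∷ xs))

  -- 0-indexed position i corresponds to 1-indexed position i+1;
  -- (i+1) odd  ⇔  i % 2 ≡ 0.
  -- The first differing position j is witnessed: agreement before j,
  -- and the comparison at j decides according to the parity of j.
  data _≺alt_ : Word → Word → Set where
    ne≺ε : ∀ {x xs} → (x ∷ xs) ≺alt []
    ≺pos : ∀ {s ss t ts} (j : ℕ)
         → (∀ i → i < j → ω s ss i ≡ ω t ts i)
         → (j % 2 ≡ 0 × ω s ss j <ₐ ω t ts j)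
           ⊎ (j % 2 ≡ 1 × ω t ts j <ₐ ω s ss j)
         → (s ∷ ss) ≺alt (t ∷ ts)

  rot : ℕ → Word → Word
  rot r W = drop r W ++ take r W

  Galois : Word → Set
  Galois W = 1 ≤ length W × (∀ r → 1 ≤ r → r < length W → W ≺alt rot r W)

  PreGalois : Word → Set
  PreGalois T = ∀ i → 1 ≤ i → i ≤ length T →
    IsPrefix (drop i T) T ⊎ T ≺alt drop i T

  GaloisRoot : Word → Word → Set
  GaloisRoot T P = IsPrefix P T × IsPeriod (length P) T × Galois P

  Odd Even : ℕ → Set
  Odd n = n % 2 ≡ 1
  Even n = n % 2 ≡ 0

  _^_ : Word → ℕ → Word
  W ^ k = concat (replicate k W)

{-# OPTIONS --safe #-}
-- A Galois word W has no nonempty border of even length b: if d = |W| − b is a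
-- period, the first difference between W^ω and its shift by d lies beyond the
-- border, and cutting off an even-length common prefix preserves the
-- alternating order; so the shift by b would be smaller than W^ω, against
-- Galois minimality. Nor is a Galois word a square, as its rotation by half
-- its length is itself.
-- Let p = |Go| and q = |P| for an even-length Galois root P. If q < 2p then
-- Go gets the period |q − p| and hence the even border q or 2p − q, unless
-- q = p, which parity forbids. If q ≥ 2p then P has period p, so P is a square
-- or has period 2p and the even border q − 2p.
module Submission where

open import Defs
open import Data.Nat using (ℕ; zero; suc; s≤s; s<s⁻¹; _+_; _*_; _∸_; _≤_; _<_; _%_; _/_; NonZero; z<s; s<s; _≤?_; _<?_)
open import Data.Nat.Properties
open import Data.Nat.DivMod using (m≡m%n+[m/n]*n; [m+n]%n≡m%n; [m+kn]%n≡m%n; m<n⇒m%n≡m; m%n<n)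
open import Data.Nat.Divisibility using (divides; m%n≡0⇒n∣m; n∣m⇒m%n≡0; ∣m+n∣m⇒∣n)
open import Data.Fin using (Fin; zero; suc; toℕ; fromℕ<)
open import Data.Fin.Properties using (toℕ-fromℕ<; fromℕ<-cong)
open import Data.List using (List; []; _∷_; _++_; length; drop; take; lookup; concat; replicate)
open import Data.List.Properties using (length-++; length-++-≤ˡ; length-drop; take++drop≡id)
open import Data.Maybe using (just)
open import Data.Maybe.Properties using (just-injective)
open import Data.Sum using (_⊎_; inj₁; inj₂)
open import Data.Product using (∃; _×_; _,_; proj₁)
open import Function using (_∘_)
open import Relation.Binary.PropositionalEquality
  using (_≡_; _≗_; refl; sym; trans; cong; subst; module ≡-Reasoning)
open import Relation.Binary.Structures using (IsStrictTotalOrder)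
open import Relation.Binary.Definitions using (tri<; tri≈; tri>)
open import Relation.Nullary using (¬_; yes; no; contradiction)

open ≡-Reasoning

even-+-% : ∀ b m → b % 2 ≡ 0 → (b + m) % 2 ≡ m % 2
even-+-% b m even with m%n≡0⇒n∣m b 2 even
... | divides c refl = trans (cong (_% 2) (+-comm (c * 2) m)) ([m+kn]%n≡m%n m c 2)

even-+-cancelʳ : ∀ m n → (m + n) % 2 ≡ 0 → n % 2 ≡ 0 → m % 2 ≡ 0
even-+-cancelʳ m n even-sum even-n = n∣m⇒m%n≡0 m 2
  (∣m+n∣m⇒∣n (m%n≡0⇒n∣m (n + m) 2 (trans (cong (_% 2) (+-comm n m)) even-sum)) (m%n≡0⇒n∣m n 2 even-n))

even-double : ∀ n → (n + n) % 2 ≡ 0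
even-double n = n∣m⇒m%n≡0 (n + n) 2 (divides n (trans (cong (n +_) (sym (+-identityʳ n))) (*-comm 2 n)))

2*length≤length-concat-replicate : ∀ {A : Set} (W V : List A) {k} → 2 ≤ k →
  length W + length W ≤ length (concat (replicate k W) ++ V)
2*length≤length-concat-replicate W V {suc (suc k)} (s≤s (s≤s _)) = ≤-trans
  (≤-trans (+-monoʳ-≤ (length W) (length-++-≤ˡ W)) (≤-reflexive (sym (length-++ W))))
  (length-++-≤ˡ (W ++ (W ++ concat (replicate k W))))

module _ {A : Set} {_<ₐ_ : A → A → Set} where
  open Words _<ₐ_

  private variable
    f g h : ℕ → A
    b d i n p q r : ℕ
    a c x y : A
    xs ys : List A
    G P U W : Word

  shift : ℕ → (ℕ → A) → ℕ → A
  shift r f i = f (r + i)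

  Periodic : ℕ → (ℕ → A) → Set
  Periodic n f = shift n f ≗ f

  periodic-shift : Periodic n f → Periodic n (shift r f)
  periodic-shift {n} {f} {r} per i = begin
    f (r + (n + i)) ≡⟨ cong f (trans (sym (+-assoc r n i)) (cong (_+ i) (+-comm r n))) ⟩
    f (n + r + i)   ≡⟨ cong f (+-assoc n r i) ⟩
    f (n + (r + i)) ≡⟨ per (r + i) ⟩
    f (r + i)       ∎

  periodic-* : Periodic n f → ∀ k i → f (k * n + i) ≡ f i
  periodic-* per zero    i = refl
  periodic-* {n} {f} per (suc k) i = begin
    f (n + k * n + i)   ≡⟨ cong f (+-assoc n (k * n) i) ⟩
    f (n + (k * n + i)) ≡⟨ per (k * n + i) ⟩
    f (k * n + i)       ≡⟨ periodic-* per k i ⟩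
    f i                 ∎

  periodic-% : .{{_ : NonZero n}} → Periodic n f → ∀ i → f i ≡ f (i % n)
  periodic-% {n} {f} per i = begin
    f i                     ≡⟨ cong f (trans (m≡m%n+[m/n]*n i n) (+-comm (i % n) _)) ⟩
    f ((i / n) * n + i % n) ≡⟨ periodic-* per (i / n) (i % n) ⟩
    f (i % n)               ∎

  periodic-ext : .{{_ : NonZero n}} → Periodic n f → Periodic n g → (∀ i → i < n → f i ≡ g i) → f ≗ g
  periodic-ext {n} {f} {g} perf perg agree i = begin
    f i       ≡⟨ periodic-% perf i ⟩
    f (i % n) ≡⟨ agree (i % n) (m%n<n i n) ⟩
    g (i % n) ≡⟨ periodic-% perg i ⟨
    g i       ∎

  infix 4 _⊑_
  _⊑_ : Word → (ℕ → A) → Set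
  W ⊑ f = ∀ i → i < length W → at W i ≡ just (f i)

  ⊑-resp : f ≗ g → W ⊑ f → W ⊑ g
  ⊑-resp f≗g W⊑f i i<n = trans (W⊑f i i<n) (cong just (f≗g i))

  ⊑-tail : (x ∷ xs) ⊑ f → xs ⊑ shift 1 f
  ⊑-tail W⊑f i i<n = W⊑f (suc i) (s<s i<n)

  ⊑-++ : ∀ U {V} → U ⊑ f → V ⊑ shift (length U) f → U ++ V ⊑ f
  ⊑-++ []      U⊑f V⊑f = V⊑f
  ⊑-++ (_ ∷ U) U⊑f V⊑f zero    _   = U⊑f zero z<s
  ⊑-++ (_ ∷ U) U⊑f V⊑f (suc i) i<n = ⊑-++ U (⊑-tail U⊑f) V⊑f i (s<s⁻¹ i<n)

  ⊑-drop : ∀ r W → W ⊑ f → drop r W ⊑ shift r f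
  ⊑-drop zero    W       W⊑f     = W⊑f
  ⊑-drop (suc r) []      W⊑f i ()
  ⊑-drop (suc r) (_ ∷ W) W⊑f     = ⊑-drop r W (⊑-tail W⊑f)

  ⊑-take : ∀ r W → W ⊑ f → take r W ⊑ f
  ⊑-take zero    W       W⊑f i       ()
  ⊑-take (suc r) []      W⊑f i       ()
  ⊑-take (suc r) (_ ∷ W) W⊑f zero    _   = W⊑f zero z<s
  ⊑-take (suc r) (_ ∷ W) W⊑f (suc i) i<n = ⊑-take r W (⊑-tail W⊑f) i (s<s⁻¹ i<n)

  ⊑-rot : r ≤ length W → Periodic (length W) f → W ⊑ f → rot r W ⊑ shift r f
  ⊑-rot {r} {W} {f} r≤n per W⊑f =
    ⊑-++ (drop r W) (⊑-drop r W W⊑f) (⊑-resp {W = take r W} wrap-around (⊑-take r W W⊑f))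
    where
    wrap-around : f ≗ shift (length (drop r W)) (shift r f)
    wrap-around i = sym (begin
      f (r + (length (drop r W) + i)) ≡⟨ cong f (sym (+-assoc r _ i)) ⟩
      f (r + length (drop r W) + i)   ≡⟨ cong (λ k → f (r + k + i)) (length-drop r W) ⟩
      f (r + (length W ∸ r) + i)      ≡⟨ cong (λ k → f (k + i)) (m+[n∸m]≡n r≤n) ⟩
      f (length W + i)                ≡⟨ per i ⟩
      f i                             ∎)

  length-rot : ∀ r W → length (rot r W) ≡ length W
  length-rot r W = begin
    length (drop r W ++ take r W)          ≡⟨ length-++ (drop r W) ⟩
    length (drop r W) + length (take r W)  ≡⟨ +-comm (length (drop r W)) _ ⟩
    length (take r W) + length (drop r W)  ≡⟨ length-++ (take r W) ⟨
    length (take r W ++ drop r W)          ≡⟨ cong length (take++drop≡id r W) ⟩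
    length W                               ∎

  at-lookup : ∀ W (k : Fin (length W)) → at W (toℕ k) ≡ just (lookup W k)
  at-lookup (_ ∷ W) zero    = refl
  at-lookup (_ ∷ W) (suc k) = at-lookup W k

  ⊑-ω : ∀ x xs → (x ∷ xs) ⊑ ω x xs
  ⊑-ω x xs i i<n = begin
    at (x ∷ xs) i                          ≡⟨ cong (at (x ∷ xs)) (toℕ-fromℕ< i<n) ⟨
    at (x ∷ xs) (toℕ (fromℕ< i<n))         ≡⟨ at-lookup (x ∷ xs) (fromℕ< i<n) ⟩
    just (lookup (x ∷ xs) (fromℕ< i<n))    ≡⟨ cong (just ∘ lookup (x ∷ xs))
                                                (fromℕ<-cong i _ (sym (m<n⇒m%n≡m i<n)) i<n (m%n<n i _)) ⟩
    just (ω x xs i)                        ∎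

  ω-periodic : ∀ x xs → Periodic (length (x ∷ xs)) (ω x xs)
  ω-periodic x xs i = cong (lookup (x ∷ xs))
    (fromℕ<-cong _ _ (trans (cong (_% ℓ) (+-comm ℓ i)) ([m+n]%n≡m%n i ℓ)) (m%n<n (ℓ + i) ℓ) (m%n<n i ℓ))
    where
    ℓ : ℕ
    ℓ = length (x ∷ xs)

  ω-unique : (x ∷ xs) ⊑ g → Periodic (length (x ∷ xs)) g → ω x xs ≗ g
  ω-unique {x} {xs} W⊑g per = periodic-ext (ω-periodic x xs) per
    λ i i<n → just-injective (trans (sym (⊑-ω x xs i i<n)) (W⊑g i i<n))

  at-++ˡ : ∀ U {V} i → i < length U → at (U ++ V) i ≡ at U i
  at-++ˡ (_ ∷ U) zero    _   = refl
  at-++ˡ (_ ∷ U) (suc i) i<n = at-++ˡ U i (s<s⁻¹ i<n)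

  at-prefix : IsPrefix U W → i < length U → at W i ≡ at U i
  at-prefix {U} (_ , refl) = at-++ˡ U _

  length-prefix : IsPrefix U W → length U ≤ length W
  length-prefix {U} (_ , refl) = length-++-≤ˡ U

  isPeriod-prefix : IsPrefix U W → IsPeriod d W → d ≤ length U → IsPeriod d U
  isPeriod-prefix {U} {W} {d} U≼W (d≥1 , _ , period) d≤u = d≥1 , d≤u , λ i i+d<u → begin
    at U (i + d) ≡⟨ at-prefix U≼W i+d<u ⟨
    at W (i + d) ≡⟨ period i (<-≤-trans i+d<u (length-prefix U≼W)) ⟩
    at W i       ≡⟨ at-prefix U≼W (≤-<-trans (m≤m+n i d) i+d<u) ⟩
    at U i       ∎

  isPeriod-+ : IsPeriod p W → IsPeriod q W → p + q ≤ length W → IsPeriod (p + q) W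
  isPeriod-+ {p} {W} {q} (p≥1 , _ , period-p) (_ , _ , period-q) p+q≤n =
    ≤-trans p≥1 (m≤m+n p q) , p+q≤n , period
    where
    period : ∀ i → i + (p + q) < length W → at W (i + (p + q)) ≡ at W i
    period i i+[p+q]<n = begin
      at W (i + (p + q)) ≡⟨ cong (at W) (+-assoc i p q) ⟨
      at W (i + p + q)   ≡⟨ period-q (i + p) i+p+q<n ⟩
      at W (i + p)       ≡⟨ period-p i (≤-<-trans (m≤m+n (i + p) q) i+p+q<n) ⟩
      at W i             ∎
      where
      i+p+q<n : i + p + q < length W
      i+p+q<n = subst (_< length W) (sym (+-assoc i p q)) i+[p+q]<n

  isPeriod-∸ : IsPeriod p W → IsPeriod q W → p < q → IsPrefix U W →
               length U + p ≤ length W → q ∸ p ≤ length U → IsPeriod (q ∸ p) U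
  isPeriod-∸ {p} {W} {q} {U} (_ , _ , period-p) (_ , _ , period-q) p<q U≼W u+p≤n d≤u =
    m<n⇒0<n∸m p<q , d≤u , period
    where
    period : ∀ i → i + (q ∸ p) < length U → at U (i + (q ∸ p)) ≡ at U i
    period i i+d<u = begin
      at U (i + (q ∸ p))     ≡⟨ at-prefix U≼W i+d<u ⟨
      at W (i + (q ∸ p))     ≡⟨ period-p (i + (q ∸ p)) i+d+p<n ⟨
      at W (i + (q ∸ p) + p) ≡⟨ cong (at W) i+d+p≡i+q ⟩
      at W (i + q)           ≡⟨ period-q i (subst (_< length W) i+d+p≡i+q i+d+p<n) ⟩
      at W i                 ≡⟨ at-prefix U≼W (≤-<-trans (m≤m+n i (q ∸ p)) i+d<u) ⟩
      at U i                 ∎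
      where
      i+d+p≡i+q : i + (q ∸ p) + p ≡ i + q
      i+d+p≡i+q = trans (+-assoc i (q ∸ p) p) (cong (i +_) (m∸n+n≡m (<⇒≤ p<q)))
      i+d+p<n : i + (q ∸ p) + p < length W
      i+d+p<n = <-≤-trans (+-monoˡ-< p i+d<u) u+p≤n

  ⊑-border : W ⊑ f → IsPeriod d W → d + b ≡ length W → ∀ i → i < b → f (d + i) ≡ f i
  ⊑-border {W} {f} {d} {b} W⊑f (_ , _ , period) d+b≡n i i<b = just-injective (begin
    just (f (d + i)) ≡⟨ cong (just ∘ f) (+-comm d i) ⟩
    just (f (i + d)) ≡⟨ W⊑f (i + d) i+d<n ⟨
    at W (i + d)     ≡⟨ period i i+d<n ⟩
    at W i           ≡⟨ W⊑f i (≤-<-trans (m≤m+n i d) i+d<n) ⟩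
    just (f i)       ∎)
    where
    i+d<n : i + d < length W
    i+d<n = subst (i + d <_) (trans (+-comm b d) d+b≡n) (+-monoˡ-< d i<b)

  AltLess : ℕ → A → A → Set
  AltLess j a c = (Even j × a <ₐ c) ⊎ (Odd j × c <ₐ a)

  infix 4 _<alt_
  _<alt_ : (ℕ → A) → (ℕ → A) → Set
  f <alt g = ∃ λ j → (∀ i → i < j → f i ≡ g i) × AltLess j (f j) (g j)

  ≺alt⇒<alt : (x ∷ xs) ≺alt (y ∷ ys) → ω x xs <alt ω y ys
  ≺alt⇒<alt (≺pos j agree less) = j , agree , less

  AltLess-parity : ∀ i j → i % 2 ≡ j % 2 → AltLess i a c → AltLess j a c
  AltLess-parity i j i≡j (inj₁ (even , a<c)) = inj₁ (trans (sym i≡j) even , a<c)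
  AltLess-parity i j i≡j (inj₂ (odd , c<a))  = inj₂ (trans (sym i≡j) odd , c<a)

  <alt-respʳ : g ≗ h → f <alt g → f <alt h
  <alt-respʳ {g} {h} {f} g≗h (j , agree , less) =
    j , (λ i i<j → trans (agree i i<j) (g≗h i)) , subst (AltLess j (f j)) (g≗h j) less

  galois-shift : Galois (x ∷ xs) → 1 ≤ r → r < length (x ∷ xs) → ω x xs <alt shift r (ω x xs)
  galois-shift {x} {xs} {r} (_ , minimal) r≥1 r<n with rot r (x ∷ xs) in eq | minimal r r≥1 r<n
  ... | []     | _     = contradiction (trans (sym (length-rot r (x ∷ xs))) (cong length eq)) 1+n≢0
  ... | y ∷ ys | W≺rot = <alt-respʳ (ω-unique rot⊑ periodic) (≺alt⇒<alt W≺rot)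
    where
    rot⊑ : (y ∷ ys) ⊑ shift r (ω x xs)
    rot⊑ = subst (_⊑ shift r (ω x xs)) eq (⊑-rot (<⇒≤ r<n) (ω-periodic x xs) (⊑-ω x xs))
    periodic : Periodic (length (y ∷ ys)) (shift r (ω x xs))
    periodic = subst (λ ℓ → Periodic ℓ (shift r (ω x xs)))
      (trans (sym (length-rot r (x ∷ xs))) (cong length eq)) (periodic-shift {r = r} (ω-periodic x xs))

  module _ (sto : IsStrictTotalOrder _≡_ _<ₐ_) where
    open IsStrictTotalOrder sto using (irrefl; asym)

    AltLess-irrefl : ∀ j → a ≡ c → ¬ AltLess j a c
    AltLess-irrefl j a≡c (inj₁ (_ , a<c)) = irrefl a≡c a<c
    AltLess-irrefl j a≡c (inj₂ (_ , c<a)) = irrefl (sym a≡c) c<a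

    AltLess-asym : ∀ j → AltLess j a c → ¬ AltLess j c a
    AltLess-asym j (inj₁ (_ , a<c))  (inj₁ (_ , c<a))  = asym a<c c<a
    AltLess-asym j (inj₂ (_ , c<a))  (inj₂ (_ , a<c))  = asym a<c c<a
    AltLess-asym j (inj₁ (even , _)) (inj₂ (odd , _))  = 0≢1+n (trans (sym even) odd)
    AltLess-asym j (inj₂ (odd , _))  (inj₁ (even , _)) = 0≢1+n (trans (sym even) odd)

    <alt-asym : f <alt g → ¬ g <alt f
    <alt-asym (j , agree , less) (k , agree′ , less′) with <-cmp j k
    ... | tri< j<k _ _  = AltLess-irrefl j (sym (agree′ j j<k)) less
    ... | tri≈ _ refl _ = AltLess-asym j less less′
    ... | tri> _ _ k<j  = AltLess-irrefl k (sym (agree k k<j)) less′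

    <alt-shift : Even b → (∀ i → i < b → f i ≡ g i) → f <alt g → shift b f <alt shift b g
    <alt-shift {b} {f} {g} even common (j , agree , less) with b ≤? j
    ... | no b≰j  = contradiction less (AltLess-irrefl j (common j (≰⇒> b≰j)))
    ... | yes b≤j =
      j ∸ b ,
      (λ i i<j∸b → agree (b + i) (subst (b + i <_) b+[j∸b]≡j (+-monoʳ-< b i<j∸b))) ,
      AltLess-parity (b + (j ∸ b)) (j ∸ b) (even-+-% b (j ∸ b) even)
        (subst (λ k → AltLess k (f k) (g k)) (sym b+[j∸b]≡j) less)
      where
      b+[j∸b]≡j : b + (j ∸ b) ≡ j
      b+[j∸b]≡j = m+[n∸m]≡n b≤j

    no-even-border : Periodic (d + b) f → Even b → (∀ i → i < b → f (d + i) ≡ f i) →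
                     f <alt shift d f → ¬ f <alt shift b f
    no-even-border {d} {b} {f} periodic even border f<shift-d =
      <alt-asym (<alt-respʳ wrap-around (<alt-shift even (λ i i<b → sym (border i i<b)) f<shift-d))
      where
      wrap-around : shift b (shift d f) ≗ f
      wrap-around i = trans (cong f (sym (+-assoc d b i))) (periodic i)

    no-square : Periodic (d + d) f → 1 ≤ d → (∀ i → i < d → f (d + i) ≡ f i) → ¬ f <alt shift d f
    no-square {d} {f} periodic d≥1 border (j , agree , less) with d ≤? j
    ... | no d≰j  = AltLess-irrefl j (sym (border j (≰⇒> d≰j))) less
    ... | yes d≤j = AltLess-irrefl j (sym tie) less
      where
      m : ℕ
      m = j ∸ d
      d+m≡j : d + m ≡ j
      d+m≡j = m+[n∸m]≡n d≤j
      tie : f (d + j) ≡ f j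
      tie = begin
        f (d + j)        ≡⟨ cong (λ k → f (d + k)) d+m≡j ⟨
        f (d + (d + m))  ≡⟨ cong f (+-assoc d d m) ⟨
        f (d + d + m)    ≡⟨ periodic m ⟩
        f m              ≡⟨ agree m (subst (m <_) d+m≡j (m<n+m m d≥1)) ⟩
        f (d + m)        ≡⟨ cong f d+m≡j ⟩
        f j              ∎

    galois-no-even-border : Galois W → IsPeriod d W → d + b ≡ length W → 1 ≤ b → ¬ Even b
    galois-no-even-border {[]} (() , _)
    galois-no-even-border {x ∷ xs} {d} {b} galois period@(d≥1 , _) d+b≡n b≥1 even =
      no-even-border {d = d} {b = b} periodic even (⊑-border (⊑-ω x xs) period d+b≡n)
        (galois-shift galois d≥1 (subst (d <_) d+b≡n (m<m+n d b≥1)))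
        (galois-shift galois b≥1 (subst (b <_) d+b≡n (m<n+m b d≥1)))
      where
      periodic : Periodic (d + b) (ω x xs)
      periodic = subst (λ ℓ → Periodic ℓ (ω x xs)) (sym d+b≡n) (ω-periodic x xs)

    galois-not-square : Galois W → IsPeriod d W → ¬ d + d ≡ length W
    galois-not-square {[]} (() , _)
    galois-not-square {x ∷ xs} {d} galois period@(d≥1 , _) d+d≡n =
      no-square {d = d} periodic d≥1 (⊑-border (⊑-ω x xs) period d+d≡n)
        (galois-shift galois d≥1 (subst (d <_) d+d≡n (m<m+n d d≥1)))
      where
      periodic : Periodic (d + d) (ω x xs)
      periodic = subst (λ ℓ → Periodic ℓ (ω x xs)) (sym d+d≡n) (ω-periodic x xs)

    even-galois-no-half-period : Galois W → Even (length W) → IsPeriod p W → ¬ p + p ≤ length W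
    even-galois-no-half-period {W} {p} galois even period 2p≤n with m≤n⇒m<n∨m≡n 2p≤n
    ... | inj₂ 2p≡n = galois-not-square galois period 2p≡n
    ... | inj₁ 2p<n = galois-no-even-border galois (isPeriod-+ {W = W} period period 2p≤n)
      (m+[n∸m]≡n 2p≤n) (m<n⇒0<n∸m 2p<n)
      (even-+-cancelʳ (length W ∸ (p + p)) (p + p)
        (subst Even (sym (m∸n+n≡m 2p≤n)) even) (even-double p))

    galois-root-no-shorter-even-period : GaloisRoot W G → IsPeriod q W → q < length G →
                                         length G + q ≤ length W → ¬ Even q
    galois-root-no-shorter-even-period {G = G} {q} (G≼W , period-G , galois) period-q q<∣G∣ ∣G∣+q≤n =
      galois-no-even-border galois
        (isPeriod-∸ period-q period-G q<∣G∣ G≼W ∣G∣+q≤n (m∸n≤m (length G) q))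
        (m∸n+n≡m (<⇒≤ q<∣G∣)) (proj₁ period-q)

    galois-root-no-longer-even-period : GaloisRoot W G → IsPeriod q W → length G < q →
      q < length G + length G → length G + length G ≤ length W → ¬ Even q
    galois-root-no-longer-even-period {G = G} {q} (G≼W , period-G , galois) period-q ∣G∣<q q<2∣G∣ 2∣G∣≤n even =
      galois-no-even-border galois
        (isPeriod-∸ period-G period-q ∣G∣<q G≼W 2∣G∣≤n (<⇒≤ d₀<∣G∣))
        (m+[n∸m]≡n (<⇒≤ d₀<∣G∣)) (m<n⇒0<n∸m d₀<∣G∣)
        (even-+-cancelʳ b₀ q (subst Even (sym b₀+q≡2∣G∣) (even-double ∣G∣)) even)
      where
      ∣G∣ d₀ b₀ : ℕ
      ∣G∣ = length G
      d₀ = q ∸ ∣G∣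
      b₀ = ∣G∣ ∸ d₀
      d₀+∣G∣≡q : d₀ + ∣G∣ ≡ q
      d₀+∣G∣≡q = m∸n+n≡m (<⇒≤ ∣G∣<q)
      d₀<∣G∣ : d₀ < ∣G∣
      d₀<∣G∣ = subst (d₀ <_) (m+n∸n≡m ∣G∣ ∣G∣) (∸-monoˡ-< q<2∣G∣ (<⇒≤ ∣G∣<q))
      b₀+q≡2∣G∣ : b₀ + q ≡ ∣G∣ + ∣G∣
      b₀+q≡2∣G∣ = begin
        b₀ + q           ≡⟨ cong (b₀ +_) d₀+∣G∣≡q ⟨
        b₀ + (d₀ + ∣G∣)  ≡⟨ +-assoc b₀ d₀ ∣G∣ ⟨
        b₀ + d₀ + ∣G∣    ≡⟨ cong (_+ ∣G∣) (trans (+-comm b₀ d₀) (m+[n∸m]≡n (<⇒≤ d₀<∣G∣))) ⟩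
        ∣G∣ + ∣G∣        ∎

    odd-galois-root-excludes-even : GaloisRoot W G → Odd (length G) → length G + length G ≤ length W →
                                    GaloisRoot W P → ¬ Even (length P)
    odd-galois-root-excludes-even {G = G} {P} root-G@(_ , period-G , _) odd 2∣G∣≤n
                                  (P≼W , period-P , galois-P) even with <-cmp (length P) (length G)
    ... | tri< q<∣G∣ _ _ = galois-root-no-shorter-even-period root-G period-P q<∣G∣
                             (≤-trans (+-monoʳ-≤ (length G) (<⇒≤ q<∣G∣)) 2∣G∣≤n) even
    ... | tri≈ _ q≡∣G∣ _ = 0≢1+n (trans (sym even) (subst Odd (sym q≡∣G∣) odd))
    ... | tri> _ _ ∣G∣<q with length P <? length G + length G
    ...   | yes q<2∣G∣ = galois-root-no-longer-even-period root-G period-P ∣G∣<q q<2∣G∣ 2∣G∣≤n even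
    ...   | no q≮2∣G∣  = even-galois-no-half-period galois-P even
                           (isPeriod-prefix P≼W period-G (<⇒≤ ∣G∣<q)) (≮⇒≥ q≮2∣G∣)

lemma16 : {A : Set} (_<ₐ_ : A → A → Set) → IsStrictTotalOrder _≡_ _<ₐ_ →
    let open Words _<ₐ_ in
    (T Go Go′ : Word) (k : ℕ) →
    PreGalois T → GaloisRoot T Go → Odd (length Go) →
    2 ≤ k → IsPrefix Go′ Go → T ≡ (Go ^ k) ++ Go′ →
    ¬ (∃ λ P → GaloisRoot T P × Even (length P))
lemma16 _<ₐ_ sto _ Go Go′ k _ root-Go odd k≥2 _ refl (P , root-P , even) =
  odd-galois-root-excludes-even sto root-Go odd (2*length≤length-concat-replicate Go Go′ k≥2) root-P even
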